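{- Let $\mathcal{T}$ be a Task Arrival Process, let $0\le t_1<t_2$, and let $\tau_i\in\mathcal{T}$ have arrival time at most $t_1$. If $\tau_i$ is assigned to a slow machine by $\mathsf{OPT}(t_1)$, then $\tau_i$ is assigned to a slow machine by $\mathsf{OPT}(t_2)$.
   Context: A task is a triple $\tau_i=(f_i,s_i,t_i)$ with $s_i\ge f_i>0$, $t_i\ge0$: running time $f_i$ on the single fast machine, $s_i$ on any of infinitely many slow machines, arrival time $t_i$ (a task cannot start before it arrives; each machine runs one task at a time). A Task Arrival Process (TAP) is a finite set of tasks. The completion time of a schedule is the time all tasks have finished. The offline algorithm $\mathsf{OPT}$, applied to a finite set of tasks with optimal offline completion time $c$, assigns each task $\tau_j$ with $s_j+t_j\le c$ to its own slow machine (started at $t_j$) and every other task to the fast machine; this assignment achieves completion time $c$. For $t\ge0$, $\mathsf{OPT}(t)$ denotes $\mathsf{OPT}$ applied to the tasks of $\mathcal{T}$ with arrival time at most $t$, and $\mathsf{C}^t$ its completion time.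
   Formalization: The running times $f_i$ and $s_i$, the arrival times $t_i$, the times $t_1$ and $t_2$, the start times of schedules and the completion times all take values in ℚ. -}

module Defs where

open import Data.Nat using (ℕ)
open import Data.Fin using (Fin)
open import Data.Rational using (ℚ; 0ℚ; _+_; _≤_; _<_)
open import Data.Product using (_×_; Σ)
open import Data.Sum using (_⊎_)
open import Relation.Binary.PropositionalEquality using (_≡_)
open import Relation.Nullary using (¬_)

record Task : Set where
  constructor task
  field
    fast    : ℚ
    slow    : ℚ
    arrival : ℚ
open Task public

ValidTask : Task → Set
ValidTask τ = (0ℚ < fast τ) × (fast τ ≤ slow τ) × (0ℚ ≤ arrival τ)

record TAP : Set where
  field
    size  : ℕ
    tasks : Fin size → Task
    valid : (i : Fin size) → ValidTask (tasks i)
open TAP public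

data Machine : Set where
  fastM : Machine
  slowM : ℕ → Machine

duration : Task → Machine → ℚ
duration τ fastM     = fast τ
duration τ (slowM _) = slow τ

record Schedule (𝒯 : TAP) (P : Fin (size 𝒯) → Set) : Set where
  field
    machine : (i : Fin (size 𝒯)) → P i → Machine
    start   : (i : Fin (size 𝒯)) → P i → ℚ
    respectsArrival : (i : Fin (size 𝒯)) (p : P i) →
      arrival (tasks 𝒯 i) ≤ start i p
    noOverlap : (i j : Fin (size 𝒯)) (p : P i) (q : P j) → ¬ (i ≡ j) →
      machine i p ≡ machine j q →
      (start i p + duration (tasks 𝒯 i) (machine i p) ≤ start j q)
      ⊎ (start j q + duration (tasks 𝒯 j) (machine j q) ≤ start i p)
open Schedule public

finish : {𝒯 : TAP} {P : Fin (size 𝒯) → Set} → Schedule 𝒯 P →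
         (i : Fin (size 𝒯)) → P i → ℚ
finish {𝒯} S i p = start S i p + duration (tasks 𝒯 i) (machine S i p)

CompletesBy : {𝒯 : TAP} {P : Fin (size 𝒯) → Set} → Schedule 𝒯 P → ℚ → Set
CompletesBy {𝒯} {P} S c = (i : Fin (size 𝒯)) (p : P i) → finish S i p ≤ c

IsOptCompletion : (𝒯 : TAP) → (Fin (size 𝒯) → Set) → ℚ → Set
IsOptCompletion 𝒯 P c =
  Σ (Schedule 𝒯 P) (λ S → CompletesBy S c)
  × ((S : Schedule 𝒯 P) (c' : ℚ) → CompletesBy S c' → c ≤ c')

ArrivedBy : (𝒯 : TAP) → ℚ → Fin (size 𝒯) → Set
ArrivedBy 𝒯 t i = arrival (tasks 𝒯 i) ≤ t

-- OPT(t), whose completion time is Cᵗ, assigns task j to a slow machine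
-- iff s_j + t_j ≤ Cᵗ.
OPTAssignsSlow : (𝒯 : TAP) → (Cᵗ : ℚ) → Fin (size 𝒯) → Set
OPTAssignsSlow 𝒯 Cᵗ j = slow (tasks 𝒯 j) + arrival (tasks 𝒯 j) ≤ Cᵗ

{-# OPTIONS --safe #-}
-- Removing tasks never increases the optimal completion time: an optimal
-- schedule of the tasks arrived by t₂, restricted to those arrived by t₁,
-- is a schedule of the latter, so C^{t₁} ≤ C^{t₂}. The criterion
-- s_i + t_i ≤ C for a slow assignment is monotone in C.
module Submission where

open import Defs
open import Data.Fin using (Fin)
open import Data.Rational using (ℚ; 0ℚ; _≤_; _<_)
open import Data.Rational.Properties using (≤-trans; <⇒≤)
open import Data.Product using (_,_)
open import Relation.Unary using (Pred; _⊆_)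
open import Level using (0ℓ)

module _ {𝒯 : TAP} {P Q : Pred (Fin (size 𝒯)) 0ℓ} (P⊆Q : P ⊆ Q) where

  restrict : Schedule 𝒯 Q → Schedule 𝒯 P
  restrict S = record
    { machine         = λ i p → machine S i (P⊆Q p)
    ; start           = λ i p → start S i (P⊆Q p)
    ; respectsArrival = λ i p → respectsArrival S i (P⊆Q p)
    ; noOverlap       = λ i j p q → noOverlap S i j (P⊆Q p) (P⊆Q q)
    }

  restrict-completesBy : (S : Schedule 𝒯 Q) {c : ℚ} →
                         CompletesBy S c → CompletesBy (restrict S) c
  restrict-completesBy S done i p = done i (P⊆Q p)

  optCompletion-mono : ∀ {c d} → IsOptCompletion 𝒯 P c → IsOptCompletion 𝒯 Q d →
                       c ≤ d
  optCompletion-mono (_ , c-optimal) ((S , S-done) , _) =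
    c-optimal (restrict S) _ (restrict-completesBy S S-done)

arrivedBy-mono : (𝒯 : TAP) {t₁ t₂ : ℚ} → t₁ ≤ t₂ → ArrivedBy 𝒯 t₁ ⊆ ArrivedBy 𝒯 t₂
arrivedBy-mono 𝒯 t₁≤t₂ tᵢ≤t₁ = ≤-trans tᵢ≤t₁ t₁≤t₂

optAssignsSlow-mono : (𝒯 : TAP) {C D : ℚ} → C ≤ D →
                      OPTAssignsSlow 𝒯 C ⊆ OPTAssignsSlow 𝒯 D
optAssignsSlow-mono 𝒯 C≤D slow≤C = ≤-trans slow≤C C≤D

lemma1 : (𝒯 : TAP) (t₁ t₂ : ℚ) → 0ℚ ≤ t₁ → t₁ < t₂ →
         (i : Fin (size 𝒯)) → ArrivedBy 𝒯 t₁ i →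
         (C¹ C² : ℚ) →
         IsOptCompletion 𝒯 (ArrivedBy 𝒯 t₁) C¹ →
         IsOptCompletion 𝒯 (ArrivedBy 𝒯 t₂) C² →
         OPTAssignsSlow 𝒯 C¹ i → OPTAssignsSlow 𝒯 C² i
lemma1 𝒯 _ _ _ t₁<t₂ _ _ C¹ C² opt¹ opt² =
  optAssignsSlow-mono 𝒯 C¹≤C²
  where
  C¹≤C² : C¹ ≤ C²
  C¹≤C² = optCompletion-mono (arrivedBy-mono 𝒯 (<⇒≤ t₁<t₂)) opt¹ opt²
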